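{- For every $0<\alpha<3/8$ there exists an integer $c=c(\alpha)$ and infinitely many oriented graphs $G$ such that both the indegree sequence and the outdegree sequence of $G$ dominate the sequence consisting of $c$ terms equal to $\alpha|G|$ followed by $|G|-c$ terms equal to $3|G|/8$, but $G$ does not contain a Hamilton cycle.
   Context: An oriented graph is a digraph with no loops and no cycles of length 2 (at most one edge between any two vertices). Its out- and indegree sequences are each sorted in non-decreasing order. A sequence $y_1,\dots,y_n$ dominates $x_1,\dots,x_n$ if $x_i\le y_i$ for all $1\le i\le n$.
   Formalization: The parameter α ranges only over the rationals strictly between 0 and 3/8. -}

module Defs where
open import Data.Bool using (Bool; true; false; if_then_else_)
open import Data.Nat using (ℕ; zero; suc; _∸_)
open import Data.Nat.Properties using (≤-decTotalOrder)
open import Data.Nat.DivMod using (_mod_)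
open import Data.Fin using (Fin; toℕ)
open import Data.List using (List; map; allFin; replicate; _++_)
open import Data.Nat.ListAction using (sum)
open import Data.List.Relation.Binary.Pointwise using (Pointwise)
open import Data.List.Sort ≤-decTotalOrder using (sort)
open import Data.Integer using (+_)
open import Data.Rational using (ℚ; _/_; _*_; _≤_)
open import Data.Fin.Permutation using (Permutation′; _⟨$⟩ʳ_)
open import Data.Product using (Σ; _×_)
open import Relation.Binary.PropositionalEquality using (_≡_)
open import Relation.Nullary using (¬_)

Digraph : ℕ → Set
Digraph n = Fin n → Fin n → Bool

IsOriented : ∀ {n} → Digraph n → Set
IsOriented {n} E =
  (∀ (u : Fin n) → E u u ≡ false) × (∀ (u v : Fin n) → E u v ≡ true → E v u ≡ false)

bit : Bool → ℕ
bit true  = 1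
bit false = 0

outdeg : ∀ {n} → Digraph n → Fin n → ℕ
outdeg {n} E u = sum (map (λ v → bit (E u v)) (allFin n))

indeg : ∀ {n} → Digraph n → Fin n → ℕ
indeg {n} E v = sum (map (λ u → bit (E u v)) (allFin n))

outdegSeq : ∀ {n} → Digraph n → List ℕ
outdegSeq {n} E = sort (map (outdeg E) (allFin n))

indegSeq : ∀ {n} → Digraph n → List ℕ
indegSeq {n} E = sort (map (indeg E) (allFin n))

ℕ→ℚ : ℕ → ℚ
ℕ→ℚ k = (+ k) / 1

Dominates : List ℚ → List ℚ → Set
Dominates ys xs = Pointwise _≤_ xs ys

targetSeq : ℚ → ℕ → ℕ → List ℚ
targetSeq α c n =
  replicate c (α * ℕ→ℚ n) ++ replicate (n ∸ c) (((+ 3) / 8) * ℕ→ℚ n)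

next : ∀ {n} → Fin n → Fin n
next {suc m} i = suc (toℕ i) mod suc m

HamiltonCycle : ∀ {n} → Digraph n → Set
HamiltonCycle {n} E =
  Σ (Permutation′ n) λ σ → ∀ (i : Fin n) → E (σ ⟨$⟩ʳ i) (σ ⟨$⟩ʳ next i) ≡ true

-- Write α = p/q, so 8p < 3q.  For each k we build (module Construction q k) an
-- oriented graph on n = 8δ + 7 vertices, δ = q(2k+5) + k + 1, with classes
-- A, C of size a = 2δ + 3, B = B₁ ∪ B₂ of size 2δ + 1 and D = D₁ ∪ D₂ of size
-- 2δ.  Between classes all edges A → C, A → B, B → C, C → D, B₁ → D₁ → B₂ →
-- D₂ → B₁, D → A are present; A and C are blow-ups of circulant tournaments
-- on 2q+1 blocks, each block being a circulant tournament plus 4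
-- exceptional vertices.  Then:
--  * every edge entering A ∪ B leaves A ∪ D and |A ∪ B| > |A ∪ D|, which by
--    a general counting lemma (noHamiltonCycle) excludes Hamilton cycles;
--  * every vertex has both degrees ≥ lo ≥ αn, and all but the c = 8(2q+1)
--    exceptional vertices have both degrees ≥ hi ≥ 3n/8; a general lemma
--    on sorted sequences (sortedValues-dominate) turns this into domination.

module Submission where

open import Defs
open import Data.Nat using (ℕ; _≥_; _≤_)
open import Data.Rational using (ℚ; 0ℚ; _<_; _/_)
open import Data.Integer using (+_)
open import Data.Product using (Σ; _×_)
open import Data.List using (map)
open import Relation.Nullary using (¬_)

import Data.Nat as ℕ
open import Data.Nat using (zero; suc; _+_; _*_; _∸_; NonZero; z≤n; s≤s; z<s; s<s; _<?_)
open import Data.Nat.Properties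
open import Data.Nat.DivMod
  using (_%_; m<n⇒m/n≡0; m<n⇒m%n≡m; m/n≡1+[m∸n]/n; [m+n]%n≡m%n; m<n*o⇒m/o<n; m%n<n; n%n≡0)
open import Data.Nat.DivMod using () renaming (_/_ to _/ℕ_)
open import Data.Nat.Tactic.RingSolver using (solve-∀)
open import Data.Bool using (Bool; true; false; if_then_else_; _∧_; _∨_; not; T)
open import Data.Unit using (⊤; tt)
open import Data.Product using (_,_; proj₁; proj₂)
import Data.Product as Product
open import Function using (_∘_; id)
open import Relation.Binary.PropositionalEquality
open import Relation.Nullary using (yes; no; does; contradiction)
open import Relation.Nullary.Decidable using (dec-true; dec-false)
open import Data.Fin as Fin using (Fin; toℕ; inject₁; fromℕ)
open import Data.Fin.Properties using (toℕ-injective; toℕ<n; toℕ-fromℕ<; toℕ-inject₁; toℕ-fromℕ)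
open import Data.Fin.Permutation using (_⟨$⟩ʳ_)
open import Data.List using (List; []; _∷_; allFin; tabulate; replicate; _++_; length)
open import Data.List.Properties using (map-tabulate; map-∘; length-map; length-tabulate)
open import Data.Nat.ListAction using (sum)
open import Data.Nat.ListAction.Properties using (sum-↭)
open import Data.List.Sort ≤-decTotalOrder using (sort; sort-↗; sort-↭)
open import Data.List.Relation.Unary.All using (All; _∷_)
import Data.List.Relation.Unary.All.Properties as All
open import Data.List.Relation.Unary.Linked as Linked using (Linked; _∷_)
open import Data.List.Relation.Binary.Pointwise using (Pointwise; []; _∷_)
open import Data.List.Relation.Binary.Permutation.Propositional using (↭-sym)
import Data.List.Relation.Binary.Permutation.Propositional.Properties as ↭
open ↭ using (All-resp-↭; ↭-length)
import Data.Rational as ℚ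
import Data.Rational.Properties as ℚP
import Data.Rational.Unnormalised as ℚᵘ
import Data.Rational.Unnormalised.Properties as ℚᵘP
import Data.Integer as ℤ
import Data.Integer.Properties as ℤP
open import Data.Nat.Coprimality using (Coprime; 1-coprimeTo; gcd≡1⇒coprime) renaming (sym to Coprime-sym)
open import Algebra.Properties.CommutativeMonoid.Sum +-0-commutativeMonoid
  using (sum-cong-≗; sum-init-last; sum-permute) renaming (sum to ∑)

lt : ℕ → ℕ → Bool
lt m n = does (m <? n)

lt-true : ∀ {m n} → m ℕ.< n → lt m n ≡ true
lt-true {m} {n} = dec-true (m <? n)

lt-false : ∀ {m n} → n ≤ m → lt m n ≡ false
lt-false {m} {n} n≤m = dec-false (m <? n) (λ m<n → <⇒≱ m<n n≤m)

lt-sound : ∀ {m n} → lt m n ≡ true → m ℕ.< n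
lt-sound {m} {n} e = <ᵇ⇒< m n (subst T (sym e) tt)

not-false : ∀ {b} → not b ≡ false → b ≡ true
not-false {true}  _ = refl
not-false {false} ()

bit-mono : ∀ {b b′} → (b ≡ true → b′ ≡ true) → bit b ≤ bit b′
bit-mono {false} _ = z≤n
bit-mono {true}  h rewrite h refl = ≤-refl

Σ< : (ℕ → ℕ) → ℕ → ℕ
Σ< g zero    = 0
Σ< g (suc m) = g 0 + Σ< (g ∘ suc) m

Σ<-cong : ∀ {g h} m → (∀ v → v ℕ.< m → g v ≡ h v) → Σ< g m ≡ Σ< h m
Σ<-cong zero    _ = refl
Σ<-cong (suc m) e = cong₂ _+_ (e 0 z<s) (Σ<-cong m (λ v v<m → e (suc v) (s<s v<m)))

Σ<-+ : ∀ g m k → Σ< g (m + k) ≡ Σ< g m + Σ< (λ v → g (m + v)) k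
Σ<-+ g zero    k = refl
Σ<-+ g (suc m) k = trans (cong (_+_ (g 0)) (Σ<-+ (g ∘ suc) m k)) (sym (+-assoc (g 0) _ _))

Σ<-const : ∀ c m → Σ< (λ _ → c) m ≡ m * c
Σ<-const c zero    = refl
Σ<-const c (suc m) = cong (_+_ c) (Σ<-const c m)

Σ<-constOn : ∀ {g} c m → (∀ v → v ℕ.< m → g v ≡ c) → Σ< g m ≡ m * c
Σ<-constOn c m e = trans (Σ<-cong m e) (Σ<-const c m)

Σ<-*ʳ : ∀ g c m → Σ< (λ v → g v * c) m ≡ Σ< g m * c
Σ<-*ʳ g c zero    = refl
Σ<-*ʳ g c (suc m) = trans (cong (_+_ (g 0 * c)) (Σ<-*ʳ (g ∘ suc) c m)) (sym (*-distribʳ-+ c (g 0) _))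

Σ<-pieces : ∀ g x y z c₁ c₂ c₃ → (∀ v → v ℕ.< x → g v ≡ c₁) →
  (∀ v → v ℕ.< y → g (x + v) ≡ c₂) → (∀ v → v ℕ.< z → g (x + y + v) ≡ c₃) →
  Σ< g (x + y + z) ≡ x * c₁ + y * c₂ + z * c₃
Σ<-pieces g x y z c₁ c₂ c₃ e₁ e₂ e₃ =
  trans (Σ<-+ g (x + y) z)
        (cong₂ _+_ (trans (Σ<-+ g x y) (cong₂ _+_ (Σ<-constOn c₁ x e₁) (Σ<-constOn c₂ y e₂)))
                   (Σ<-constOn c₃ z e₃))

Σ<-point : ∀ {g h} b m → b ℕ.< m → (∀ v → v ≢ b → g v ≡ h v) → h b ≡ 0 →
  Σ< g m ≡ g b + Σ< h m
Σ<-point {g} {h} zero (suc m) _ off hb rewrite hb =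
  cong (_+_ (g 0)) (Σ<-cong m (λ v _ → off (suc v) (λ ())))
Σ<-point {g} {h} (suc b) (suc m) (s<s b<m) off hb =
  begin
    g 0 + Σ< (g ∘ suc) m
      ≡⟨ cong₂ _+_ (off 0 (λ ())) (Σ<-point b m b<m (λ v v≢b → off (suc v) (v≢b ∘ suc-injective)) hb) ⟩
    h 0 + (g (suc b) + Σ< (h ∘ suc) m)
      ≡⟨ swap-front (h 0) (g (suc b)) _ ⟩
    g (suc b) + (h 0 + Σ< (h ∘ suc) m) ∎
  where
  open ≡-Reasoning
  swap-front : ∀ x y z → x + (y + z) ≡ y + (x + z)
  swap-front = solve-∀

Σ<-blocks : ∀ P .{{_ : NonZero P}} (h : ℕ → ℕ → ℕ) r →
  Σ< (λ v → h (v /ℕ P) (v % P)) (r * P) ≡ Σ< (λ β → Σ< (h β) P) r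
Σ<-blocks P h zero    = refl
Σ<-blocks P h (suc r) =
  trans (Σ<-+ _ P (r * P))
        (cong₂ _+_ (Σ<-cong P (λ v v<P → cong₂ h (m<n⇒m/n≡0 v<P) (m<n⇒m%n≡m v<P)))
                   (trans (Σ<-cong (r * P) (λ v _ → cong₂ h (next-block v) (next-position v)))
                          (Σ<-blocks P (h ∘ suc) r)))
  where
  next-block : ∀ v → (P + v) /ℕ P ≡ suc (v /ℕ P)
  next-block v = trans (m/n≡1+[m∸n]/n (m≤m+n P v)) (cong (λ x → suc (x /ℕ P)) (m+n∸m≡n P v))
  next-position : ∀ v → (P + v) % P ≡ v % P
  next-position v = trans (cong (_% P) (+-comm P v)) ([m+n]%n≡m%n v P)

glue : ∀ {V : Set} → ℕ → (ℕ → V) → (ℕ → V) → ℕ → V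
glue m p rest v = if lt v m then p v else rest (v ∸ m)

Σ<-glue : ∀ {V : Set} (f : V → ℕ) m p rest k →
  Σ< (f ∘ glue m p rest) (m + k) ≡ Σ< (f ∘ p) m + Σ< (f ∘ rest) k
Σ<-glue f m p rest k =
  trans (Σ<-+ _ m k)
        (cong₂ _+_ (Σ<-cong m (λ v v<m → cong (λ b → f (if b then p v else rest (v ∸ m))) (lt-true v<m)))
                   (Σ<-cong k (λ v _ → cong₂ (λ b x → f (if b then p (m + v) else rest x))
                                              (lt-false (m≤m+n m v)) (m+n∸m≡n m v))))

glue-all : ∀ {V : Set} (Q : V → Set) m p rest k u → u ℕ.< m + k →
  (∀ v → v ℕ.< m → Q (p v)) → (∀ v → v ℕ.< k → Q (rest v)) → Q (glue m p rest u)
glue-all Q m p rest k u u< Qp Qrest with u <? m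
... | yes u<m = subst (λ b → Q (if b then p u else rest (u ∸ m))) (sym (lt-true u<m)) (Qp u u<m)
... | no  u≮m = subst (λ b → Q (if b then p u else rest (u ∸ m))) (sym (lt-false (≮⇒≥ u≮m)))
                  (Qrest (u ∸ m) (subst (u ∸ m ℕ.<_) (m+n∸m≡n m k) (∸-monoˡ-< u< (≮⇒≥ u≮m))))

-- The circulant tournament on 2k+1 points: i → j iff j − i ∈ {1, …, k}
-- modulo 2k+1.  It is regular: every point has in- and outdegree k.
tour : ℕ → ℕ → ℕ → Bool
tour k i j = (lt i j ∧ lt j (suc (i + k))) ∨ lt (j + k) i

tour-by : ∀ k i j {x y z} → lt i j ≡ x → lt j (suc (i + k)) ≡ y → lt (j + k) i ≡ z →
  tour k i j ≡ (x ∧ y) ∨ z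
tour-by k i j p q r = cong₂ _∨_ (cong₂ _∧_ p q) r

tour-irrefl : ∀ k i → tour k i i ≡ false
tour-irrefl k i = tour-by k i i (lt-false {i} {i} ≤-refl) refl (lt-false (m≤m+n i k))

tour-anti : ∀ k i j → tour k i j ≡ true → tour k j i ≡ false
tour-anti k i j e with i <? j
... | yes i<j with j ℕ.≤? i + k
...   | yes j≤i+k = tour-by k j i (lt-false (<⇒≤ i<j)) refl (lt-false (≤-trans j≤i+k (m≤n+m (i + k) 0)))
...   | no  j≰i+k
        rewrite lt-true {i} {j} i<j | lt-false {j} {suc (i + k)} (≰⇒> j≰i+k)
              | lt-false {j + k} {i} (≤-trans (<⇒≤ i<j) (m≤m+n j k)) with e
...     | ()
tour-anti k i j e | no i≮j with (j + k) <? i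
... | yes j+k<i = tour-by k j i (lt-true (≤-trans (s≤s (m≤m+n j k)) j+k<i)) (lt-false j+k<i)
                    (lt-false (≤-trans (<⇒≤ (≤-trans (s≤s (m≤m+n j k)) j+k<i)) (m≤m+n i k)))
... | no  j+k≮i rewrite lt-false {i} {j} (≮⇒≥ i≮j) | lt-false {j + k} {i} (≮⇒≥ j+k≮i) with e
...   | ()

private
  one-range : ∀ x y z → x * 0 + y * 1 + z * 0 ≡ y
  one-range = solve-∀

  two-ranges : ∀ x y z → x * 1 + y * 0 + z * 1 ≡ x + z
  two-ranges = solve-∀

-- Outdegree of a point i = k + 1 + e in the upper half: its out-neighbours
-- are 0, …, e and i + 1, …, 2k.
tour-outdeg-upper : ∀ e f → let k = suc e + f in
  Σ< (λ j → bit (tour k (suc k + e) j)) (suc (k + k)) ≡ k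
tour-outdeg-upper e f =
  trans (cong (Σ< (λ j → bit (tour k i j))) (layout e f))
        (trans (Σ<-pieces (λ j → bit (tour k i j)) (suc e) (suc k) f 1 0 1 low mid high)
               (two-ranges (suc e) (suc k) f))
  where
  k = suc e + f
  i = suc k + e
  layout : ∀ e f → suc ((suc e + f) + (suc e + f)) ≡ suc e + suc (suc e + f) + f
  layout = solve-∀
  low : ∀ v → v ℕ.< suc e → bit (tour k i v) ≡ 1
  low v (s≤s v≤e) = cong bit (tour-by k i v (lt-false (≤-trans v≤e (m≤n+m e (suc k)))) refl
    (lt-true (s≤s (≤-trans (+-monoˡ-≤ k v≤e) (≤-reflexive (+-comm e k))))))
  mid : ∀ v → v ℕ.< suc k → bit (tour k i (suc e + v)) ≡ 0
  mid v (s≤s v≤k) = cong bit (tour-by k i (suc e + v)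
    (lt-false (s≤s (≤-trans (+-monoʳ-≤ e v≤k) (≤-reflexive (+-comm e k))))) refl
    (lt-false (s≤s (≤-trans (≤-reflexive (+-comm k e)) (+-monoˡ-≤ k (m≤m+n e v))))))
  i<high : ∀ v → i ℕ.< suc e + suc k + v
  i<high v = s≤s (≤-trans (≤-reflexive (trans (cong suc (+-comm k e)) (sym (+-suc e k)))) (m≤m+n _ v))
  shift : ∀ e k v → e + suc k + v ≡ e + k + suc v
  shift = solve-∀
  high : ∀ v → v ℕ.< f → bit (tour k i (suc e + suc k + v)) ≡ 1
  high v v<f = cong bit (tour-by k i (suc e + suc k + v) (lt-true (i<high v))
    (lt-true (s≤s (s≤s (≤-trans (≤-reflexive (shift e k v))
      (≤-trans (+-monoʳ-≤ (e + k) (≤-trans v<f (m≤n+m f (suc e)))) (≤-reflexive (cong (_+ k) (+-comm e k))))))))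
    (lt-false (≤-trans (<⇒≤ (i<high v)) (m≤m+n _ k))))

tour-outdeg : ∀ k i → i ℕ.< suc (k + k) → Σ< (λ j → bit (tour k i j)) (suc (k + k)) ≡ k
tour-outdeg k i i<m with i ℕ.≤? k
... | yes i≤k =
  trans (cong (Σ< (λ j → bit (tour k i j))) layout)
        (trans (Σ<-pieces (λ j → bit (tour k i j)) (suc i) k (k ∸ i) 0 1 0 low mid high)
               (one-range (suc i) k (k ∸ i)))
  where
  layout : suc (k + k) ≡ suc i + k + (k ∸ i)
  layout = cong suc (trans (cong (_+ k) (sym (m+[n∸m]≡n i≤k)))
    (trans (+-assoc i _ k) (trans (cong (_+_ i) (+-comm (k ∸ i) k)) (sym (+-assoc i k _)))))
  low : ∀ v → v ℕ.< suc i → bit (tour k i v) ≡ 0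
  low v (s≤s v≤i) = cong bit (tour-by k i v (lt-false v≤i) refl (lt-false (≤-trans i≤k (m≤n+m k v))))
  mid : ∀ v → v ℕ.< k → bit (tour k i (suc i + v)) ≡ 1
  mid v v<k = cong bit (tour-by k i (suc i + v) (lt-true (s≤s (m≤m+n i v))) (lt-true (s≤s (+-monoʳ-< i v<k))) refl)
  high : ∀ v → v ℕ.< k ∸ i → bit (tour k i (suc i + k + v)) ≡ 0
  high v _ = cong bit (tour-by k i (suc i + k + v) (lt-true (s≤s (≤-trans (m≤m+n i k) (m≤m+n (i + k) v))))
    (lt-false (s≤s (m≤m+n (i + k) v)))
    (lt-false (≤-trans (n≤1+n i) (≤-trans (m≤m+n (suc i) k) (≤-trans (m≤m+n (suc i + k) v) (m≤m+n _ k))))))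
... | no i≰k with m≤n⇒∃[o]m+o≡n (≰⇒> i≰k)
...   | e , refl with m≤n⇒∃[o]m+o≡n (+-cancelˡ-< k e k (≤-pred i<m))
...     | f , refl = tour-outdeg-upper e f

-- Indegree of a point j = k + 1 + e in the upper half: its in-neighbours
-- are e + 1, …, k + e.
tour-indeg-upper : ∀ e f → let k = suc e + f in
  Σ< (λ i → bit (tour k i (suc k + e))) (suc (k + k)) ≡ k
tour-indeg-upper e f =
  trans (cong (Σ< (λ i → bit (tour k i j))) (layout e f))
        (trans (Σ<-pieces (λ i → bit (tour k i j)) (suc e) k (suc f) 0 1 0 low mid high)
               (one-range (suc e) k (suc f)))
  where
  k = suc e + f
  j = suc k + e
  layout : ∀ e f → suc ((suc e + f) + (suc e + f)) ≡ suc e + (suc e + f) + suc f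
  layout = solve-∀
  low : ∀ v → v ℕ.< suc e → bit (tour k v j) ≡ 0
  low v (s≤s v≤e) = cong bit (tour-by k v j (lt-true (s≤s (≤-trans v≤e (m≤n+m e k))))
    (lt-false (s≤s (≤-trans (+-monoˡ-≤ k v≤e) (≤-reflexive (+-comm e k)))))
    (lt-false (≤-trans (≤-trans v≤e (m≤n+m e (suc k))) (m≤m+n j k))))
  mid : ∀ v → v ℕ.< k → bit (tour k (suc e + v) j) ≡ 1
  mid v v<k = cong bit (tour-by k (suc e + v) j
    (lt-true (s≤s (s≤s (≤-trans (≤-reflexive (sym (+-suc e v))) (≤-trans (+-monoʳ-≤ e v<k) (≤-reflexive (+-comm e k)))))))
    (lt-true (s≤s (s≤s (≤-trans (≤-reflexive (+-comm k e)) (+-monoˡ-≤ k (m≤m+n e v))))))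
    (lt-false (≤-trans (s≤s (≤-trans (+-monoʳ-≤ e (<⇒≤ v<k)) (≤-reflexive (+-comm e k)))) (m≤m+n j k))))
  high : ∀ v → v ℕ.< suc f → bit (tour k (suc e + k + v) j) ≡ 0
  high v (s≤s v≤f) = cong bit (tour-by k (suc e + k + v) j
    (lt-false (s≤s (≤-trans (≤-reflexive (+-comm k e)) (m≤m+n (e + k) v))))
    (lt-true (s≤s (≤-trans (s≤s (≤-trans (≤-reflexive (+-comm k e)) (m≤m+n (e + k) v))) (m≤m+n _ k))))
    (lt-false (s≤s (≤-trans (+-monoʳ-≤ (e + k) (≤-trans v≤f (m≤n+m f (suc e)))) (≤-reflexive (cong (_+ k) (+-comm e k)))))))

tour-indeg : ∀ k j → j ℕ.< suc (k + k) → Σ< (λ i → bit (tour k i j)) (suc (k + k)) ≡ k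
tour-indeg k j j<m with j ℕ.≤? k
... | yes j≤k =
  trans (cong (Σ< (λ i → bit (tour k i j))) layout)
        (trans (Σ<-pieces (λ i → bit (tour k i j)) j (suc k) (k ∸ j) 1 0 1 low mid high)
               (trans (two-ranges j (suc k) (k ∸ j)) (m+[n∸m]≡n j≤k)))
  where
  layout : suc (k + k) ≡ j + suc k + (k ∸ j)
  layout = trans (cong suc (cong (_+ k) (sym (m+[n∸m]≡n j≤k))))
    (trans (sym (+-suc (j + (k ∸ j)) k)) (trans (+-assoc j (k ∸ j) (suc k))
      (trans (cong (_+_ j) (+-comm (k ∸ j) (suc k))) (sym (+-assoc j (suc k) (k ∸ j))))))
  low : ∀ v → v ℕ.< j → bit (tour k v j) ≡ 1
  low v v<j = cong bit (tour-by k v j (lt-true v<j) (lt-true (s≤s (≤-trans j≤k (m≤n+m k v))))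
    (lt-false (≤-trans (<⇒≤ v<j) (m≤m+n j k))))
  mid : ∀ v → v ℕ.< suc k → bit (tour k (j + v) j) ≡ 0
  mid v (s≤s v≤k) = cong bit (tour-by k (j + v) j (lt-false (m≤m+n j v))
    (lt-true (s≤s (≤-trans (m≤m+n j v) (m≤m+n _ k)))) (lt-false (+-monoʳ-≤ j v≤k)))
  high : ∀ v → v ℕ.< k ∸ j → bit (tour k (j + suc k + v) j) ≡ 1
  high v _ = cong bit (tour-by k (j + suc k + v) j (lt-false (≤-trans (m≤m+n j (suc k)) (m≤m+n _ v)))
    (lt-true (s≤s (≤-trans (≤-trans (m≤m+n j (suc k)) (m≤m+n _ v)) (m≤m+n _ k))))
    (lt-true (≤-trans (≤-reflexive (sym (+-suc j k))) (m≤m+n _ v))))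
... | no j≰k with m≤n⇒∃[o]m+o≡n (≰⇒> j≰k)
...   | e , refl with m≤n⇒∃[o]m+o≡n (+-cancelˡ-< k e k (≤-pred j<m))
...     | f , refl = tour-indeg-upper e f

blowUp : ℕ → (ℕ → ℕ → Bool) → ℕ → ℕ → ℕ → ℕ → Bool
blowUp q inner β w β′ w′ = if does (β′ ≟ β) then inner w w′ else tour q β β′

blowUp-same : ∀ q inner β w w′ → blowUp q inner β w β w′ ≡ inner w w′
blowUp-same q inner β w w′ = cong (λ d → if does d then inner w w′ else tour q β β) (≟-diag {β} {β} refl)

blowUp-apart : ∀ q inner β w β′ w′ → β′ ≢ β → blowUp q inner β w β′ w′ ≡ tour q β β′
blowUp-apart q inner β w β′ w′ β′≢β =
  cong (λ b → if b then inner w w′ else tour q β β′) (dec-false (β′ ≟ β) β′≢β)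

blowUp-irrefl : ∀ q inner β w → inner w w ≡ false → blowUp q inner β w β w ≡ false
blowUp-irrefl q inner β w = trans (blowUp-same q inner β w w)

blowUp-anti : ∀ q inner → (∀ w w′ → inner w w′ ≡ true → inner w′ w ≡ false) →
  ∀ β w β′ w′ → blowUp q inner β w β′ w′ ≡ true → blowUp q inner β′ w′ β w ≡ false
blowUp-anti q inner anti β w β′ w′ e with β′ ≟ β
... | yes refl = trans (blowUp-same q inner β′ w′ w) (anti w w′ (trans (sym (blowUp-same q inner β w w′)) e))
... | no β′≢β  = trans (blowUp-apart q inner β′ w′ β w (β′≢β ∘ sym))
                       (tour-anti q β β′ (trans (sym (blowUp-apart q inner β w β′ w′ β′≢β)) e))

blowUp-indeg : ∀ q P inner β₀ w₀ → β₀ ℕ.< suc (q + q) →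
  Σ< (λ β → Σ< (λ w → bit (blowUp q inner β w β₀ w₀)) P) (suc (q + q))
    ≡ Σ< (λ w → bit (inner w w₀)) P + q * P
blowUp-indeg q P inner β₀ w₀ β₀<r = begin
  Σ< block r
    ≡⟨ Σ<-point β₀ r β₀<r apart (cong (λ b → bit b * P) (tour-irrefl q β₀)) ⟩
  block β₀ + Σ< (λ β → bit (tour q β β₀) * P) r
    ≡⟨ cong₂ _+_ (Σ<-cong P (λ w _ → cong bit (blowUp-same q inner β₀ w w₀)))
                 (Σ<-*ʳ (λ β → bit (tour q β β₀)) P r) ⟩
  Σ< (λ w → bit (inner w w₀)) P + Σ< (λ β → bit (tour q β β₀)) r * P
    ≡⟨ cong (λ t → Σ< (λ w → bit (inner w w₀)) P + t * P) (tour-indeg q β₀ β₀<r) ⟩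
  Σ< (λ w → bit (inner w w₀)) P + q * P ∎
  where
  open ≡-Reasoning
  r = suc (q + q)
  block : ℕ → ℕ
  block β = Σ< (λ w → bit (blowUp q inner β w β₀ w₀)) P
  apart : ∀ β → β ≢ β₀ → block β ≡ bit (tour q β β₀) * P
  apart β β≢β₀ = trans (Σ<-constOn _ P (λ w _ → cong bit (blowUp-apart q inner β w β₀ w₀ (β≢β₀ ∘ sym))))
                       (*-comm P _)

blowUp-outdeg : ∀ q P inner β₀ w₀ → β₀ ℕ.< suc (q + q) →
  Σ< (λ β → Σ< (λ w → bit (blowUp q inner β₀ w₀ β w)) P) (suc (q + q))
    ≡ Σ< (λ w → bit (inner w₀ w)) P + q * P
blowUp-outdeg q P inner β₀ w₀ β₀<r = begin
  Σ< block r
    ≡⟨ Σ<-point β₀ r β₀<r apart (cong (λ b → bit b * P) (tour-irrefl q β₀)) ⟩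
  block β₀ + Σ< (λ β → bit (tour q β₀ β) * P) r
    ≡⟨ cong₂ _+_ (Σ<-cong P (λ w _ → cong bit (blowUp-same q inner β₀ w₀ w)))
                 (Σ<-*ʳ (λ β → bit (tour q β₀ β)) P r) ⟩
  Σ< (λ w → bit (inner w₀ w)) P + Σ< (λ β → bit (tour q β₀ β)) r * P
    ≡⟨ cong (λ t → Σ< (λ w → bit (inner w₀ w)) P + t * P) (tour-outdeg q β₀ β₀<r) ⟩
  Σ< (λ w → bit (inner w₀ w)) P + q * P ∎
  where
  open ≡-Reasoning
  r = suc (q + q)
  block : ℕ → ℕ
  block β = Σ< (λ w → bit (blowUp q inner β₀ w₀ β w)) P
  apart : ∀ β → β ≢ β₀ → block β ≡ bit (tour q β₀ β) * P
  apart β β≢β₀ = trans (Σ<-constOn _ P (λ w _ → cong bit (blowUp-apart q inner β₀ w₀ β w β≢β₀)))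
                       (*-comm P _)

-- Blocks consist of L = 2k+1 regular positions followed by exceptional ones.
innerA : ℕ → ℕ → ℕ → Bool
innerA k w w′ = if lt w (suc (k + k)) then (lt w′ (suc (k + k)) ∧ tour k w w′) else lt w′ (suc (k + k))

innerC : ℕ → ℕ → ℕ → Bool
innerC k w w′ = if lt w (suc (k + k)) then (if lt w′ (suc (k + k)) then tour k w w′ else true) else false

innerA-irrefl : ∀ k w → innerA k w w ≡ false
innerA-irrefl k w = shape (lt w (suc (k + k))) (tour-irrefl k w)
  where
  shape : ∀ b {t} → t ≡ false → (if b then (b ∧ t) else b) ≡ false
  shape true  t≡false = t≡false
  shape false _       = refl

innerC-irrefl : ∀ k w → innerC k w w ≡ false
innerC-irrefl k w = shape (lt w (suc (k + k))) (tour-irrefl k w)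
  where
  shape : ∀ b {t} → t ≡ false → (if b then (if b then t else true) else false) ≡ false
  shape true  t≡false = t≡false
  shape false _       = refl

innerA-anti : ∀ k w w′ → innerA k w w′ ≡ true → innerA k w′ w ≡ false
innerA-anti k w w′ = shape (lt w (suc (k + k))) (lt w′ (suc (k + k))) (tour-anti k w w′)
  where
  shape : ∀ b b′ {t t′} → (t ≡ true → t′ ≡ false) →
    (if b then (b′ ∧ t) else b′) ≡ true → (if b′ then (b ∧ t′) else b) ≡ false
  shape true  true  anti e  = anti e
  shape true  false _    ()
  shape false true  _    _  = refl
  shape false false _    ()

innerC-anti : ∀ k w w′ → innerC k w w′ ≡ true → innerC k w′ w ≡ false
innerC-anti k w w′ = shape (lt w (suc (k + k))) (lt w′ (suc (k + k))) (tour-anti k w w′)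
  where
  shape : ∀ b b′ {t t′} → (t ≡ true → t′ ≡ false) →
    (if b then (if b′ then t else true) else false) ≡ true → (if b′ then (if b then t′ else true) else false) ≡ false
  shape true  true  anti e = anti e
  shape true  false _    _ = refl
  shape false _     _    ()

innerA-indeg : ∀ k e w₀ → w₀ ℕ.< suc (k + k) → Σ< (λ w → bit (innerA k w w₀)) (suc (k + k) + e) ≡ k + e
innerA-indeg k e w₀ w₀<L = trans (Σ<-+ (λ w → bit (innerA k w w₀)) L e) (cong₂ _+_
  (trans (Σ<-cong L (λ w w<L → cong bit
           (trans (cong (λ b → if b then (lt w₀ L ∧ tour k w w₀) else lt w₀ L) (lt-true w<L))
                  (cong (λ b → b ∧ tour k w w₀) (lt-true w₀<L)))))
         (tour-indeg k w₀ w₀<L))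
  (trans (Σ<-constOn 1 e (λ t _ → cong bit
           (trans (cong (λ b → if b then (lt w₀ L ∧ tour k (L + t) w₀) else lt w₀ L) (lt-false (m≤m+n L t)))
                  (lt-true w₀<L))))
         (*-identityʳ e)))
  where L = suc (k + k)

innerC-outdeg : ∀ k e w₀ → w₀ ℕ.< suc (k + k) → Σ< (λ w → bit (innerC k w₀ w)) (suc (k + k) + e) ≡ k + e
innerC-outdeg k e w₀ w₀<L = trans (Σ<-+ (λ w → bit (innerC k w₀ w)) L e) (cong₂ _+_
  (trans (Σ<-cong L (λ w w<L → cong bit
           (trans (cong (λ b → if b then (if lt w L then tour k w₀ w else true) else false) (lt-true w₀<L))
                  (cong (λ b → if b then tour k w₀ w else true) (lt-true w<L)))))
         (tour-outdeg k w₀ w₀<L))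
  (trans (Σ<-constOn 1 e (λ t _ → cong bit
           (trans (cong (λ b → if b then (if lt (L + t) L then tour k w₀ (L + t) else true) else false) (lt-true w₀<L))
                  (cong (λ b → if b then tour k w₀ (L + t) else true) (lt-false (m≤m+n L t))))))
         (*-identityʳ e)))
  where L = suc (k + k)

exceptional-count : ∀ k e → Σ< (λ w → bit (not (lt w (suc (k + k))))) (suc (k + k) + e) ≡ e
exceptional-count k e = trans (Σ<-+ (λ w → bit (not (lt w L))) L e) (cong₂ _+_
  (trans (Σ<-constOn 0 L (λ w w<L → cong (bit ∘ not) (lt-true w<L))) (*-zeroʳ L))
  (trans (Σ<-constOn 1 e (λ t _ → cong (bit ∘ not) (lt-false (m≤m+n L t)))) (*-identityʳ e)))
  where L = suc (k + k)

count : ∀ {n} → (Fin n → Bool) → ℕ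
count {n} X = sum (map (bit ∘ X) (allFin n))

sum-allFin : ∀ {m} (f : Fin m → ℕ) → sum (map f (allFin m)) ≡ ∑ f
sum-allFin {m} f = trans (cong sum (map-tabulate {n = m} id f)) (sum-tabulate f)
  where
  sum-tabulate : ∀ {m} (f : Fin m → ℕ) → sum (tabulate f) ≡ ∑ f
  sum-tabulate {zero}  f = refl
  sum-tabulate {suc m} f = cong (_+_ (f Fin.zero)) (sum-tabulate (f ∘ Fin.suc))

∑-toℕ : ∀ m (g : ℕ → ℕ) → ∑ {m} (g ∘ toℕ) ≡ Σ< g m
∑-toℕ zero    g = refl
∑-toℕ (suc m) g = cong (_+_ (g 0)) (∑-toℕ m (g ∘ suc))

sum-allFin-toℕ : ∀ m (g : ℕ → ℕ) → sum (map (g ∘ toℕ) (allFin m)) ≡ Σ< g m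
sum-allFin-toℕ m g = trans (sum-allFin {m} (g ∘ toℕ)) (∑-toℕ m g)

∑-mono : ∀ {m} {f g : Fin m → ℕ} → (∀ i → f i ≤ g i) → ∑ f ≤ ∑ g
∑-mono {zero}  _ = z≤n
∑-mono {suc m} h = +-mono-≤ (h Fin.zero) (∑-mono (h ∘ Fin.suc))

next-inject₁ : ∀ m (j : Fin m) → next {suc m} (inject₁ j) ≡ Fin.suc j
next-inject₁ m j = toℕ-injective (begin
  toℕ (next {suc m} (inject₁ j))  ≡⟨ toℕ-fromℕ< (m%n<n (suc (toℕ (inject₁ j))) (suc m)) ⟩
  suc (toℕ (inject₁ j)) % suc m    ≡⟨ m<n⇒m%n≡m (s≤s (subst (ℕ._< m) (sym (toℕ-inject₁ j)) (toℕ<n j))) ⟩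
  suc (toℕ (inject₁ j))            ≡⟨ cong suc (toℕ-inject₁ j) ⟩
  suc (toℕ j)                      ∎)
  where open ≡-Reasoning

next-fromℕ : ∀ m → next {suc m} (fromℕ m) ≡ Fin.zero
next-fromℕ m = toℕ-injective (begin
  toℕ (next {suc m} (fromℕ m))  ≡⟨ toℕ-fromℕ< (m%n<n (suc (toℕ (fromℕ m))) (suc m)) ⟩
  suc (toℕ (fromℕ m)) % suc m    ≡⟨ cong (λ x → suc x % suc m) (toℕ-fromℕ m) ⟩
  suc m % suc m                  ≡⟨ n%n≡0 (suc m) ⟩
  0                              ∎)
  where open ≡-Reasoning

∑-next : ∀ m (f : Fin (suc m) → ℕ) → ∑ (f ∘ next) ≡ ∑ f
∑-next m f = begin
  ∑ (f ∘ next)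
    ≡⟨ sum-init-last (f ∘ next) ⟩
  ∑ (f ∘ next ∘ inject₁) + f (next (fromℕ m))
    ≡⟨ cong₂ _+_ (sum-cong-≗ (cong f ∘ next-inject₁ m)) (cong f (next-fromℕ m)) ⟩
  ∑ (f ∘ Fin.suc) + f Fin.zero
    ≡⟨ +-comm _ (f Fin.zero) ⟩
  ∑ f ∎
  where open ≡-Reasoning

-- The Hamilton-cycle obstruction.  If every edge entering the vertex set X
-- starts in Y, a Hamilton cycle enters each vertex of X once, each time from
-- a different vertex of Y, so |X| ≤ |Y|.
noHamiltonCycle : ∀ {n} (E : Digraph n) (X Y : Fin n → Bool) →
  (∀ u v → E u v ≡ true → X v ≡ true → Y u ≡ true) →
  count Y ℕ.< count X → ¬ HamiltonCycle E
noHamiltonCycle {zero}  _ _ _ _     ()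
noHamiltonCycle {suc m} E X Y entry Y<X (σ , cycle) = <⇒≱ Y<X X≤Y
  where
  π : Fin (suc m) → Fin (suc m)
  π = σ ⟨$⟩ʳ_
  X≤Y : count X ≤ count Y
  X≤Y = begin
    count X                   ≡⟨ sum-allFin (bit ∘ X) ⟩
    ∑ (bit ∘ X)               ≡⟨ sum-permute (bit ∘ X) σ ⟩
    ∑ (bit ∘ X ∘ π)           ≡⟨ sym (∑-next m (bit ∘ X ∘ π)) ⟩
    ∑ (bit ∘ X ∘ π ∘ next)    ≤⟨ ∑-mono (λ i → bit-mono (entry (π i) (π (next i)) (cycle i))) ⟩
    ∑ (bit ∘ Y ∘ π)           ≡⟨ sym (sum-permute (bit ∘ Y) σ) ⟩
    ∑ (bit ∘ Y)               ≡⟨ sym (sum-allFin (bit ∘ Y)) ⟩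
    count Y                   ∎
    where open ≤-Reasoning

countBelow : ℕ → List ℕ → ℕ
countBelow h xs = sum (map (λ x → bit (lt x h)) xs)

countBelow-sorted : ∀ h x xs → Linked _≤_ (x ∷ xs) → h ≤ x → countBelow h xs ≡ 0
countBelow-sorted h x []       _               _   = refl
countBelow-sorted h x (y ∷ ys) (x≤y ∷ sorted) h≤x =
  cong₂ _+_ (cong bit (lt-false (≤-trans h≤x x≤y))) (countBelow-sorted h y ys sorted (≤-trans h≤x x≤y))

countBelow-tail : ∀ h x xs c → Linked _≤_ (x ∷ xs) → countBelow h (x ∷ xs) ≤ suc c → countBelow h xs ≤ c
countBelow-tail h x xs c sorted below with x <? h
... | yes x<h = ≤-pred (subst (λ b → bit b + countBelow h xs ≤ suc c) (lt-true x<h) below)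
... | no  x≮h = subst (_≤ c) (sym (countBelow-sorted h x xs sorted (≮⇒≥ x≮h))) z≤n

ℕ→ℚ-normal : ∀ m → ℕ→ℚ m ≡ ℚ.mkℚ (+ m) 0 (Coprime-sym (1-coprimeTo m))
ℕ→ℚ-normal m = ℚP.normalize-coprime (Coprime-sym (1-coprimeTo m))

ℕ→ℚ-mono : ∀ {m k} → m ≤ k → ℕ→ℚ m ℚ.≤ ℕ→ℚ k
ℕ→ℚ-mono {m} {k} m≤k rewrite ℕ→ℚ-normal m | ℕ→ℚ-normal k =
  ℚ.*≤* (subst₂ ℤ._≤_ (sym (ℤP.*-identityʳ (+ m))) (sym (ℤP.*-identityʳ (+ k))) (ℤ.+≤+ m≤k))

sorted-dominates : ∀ lo hi {y z : ℚ} → y ℚ.≤ ℕ→ℚ lo → z ℚ.≤ ℕ→ℚ hi →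
  ∀ c xs → Linked _≤_ xs → All (lo ≤_) xs → countBelow hi xs ≤ c → c ≤ length xs →
  Pointwise ℚ._≤_ (replicate c y ++ replicate (length xs ∸ c) z) (map ℕ→ℚ xs)
sorted-dominates _ _ _ _ zero [] _ _ _ _ = []
sorted-dominates lo hi y≤lo z≤hi zero (x ∷ xs) sorted (_ ∷ all≥lo) below _ with x <? hi
... | yes x<hi with subst (λ b → bit b + countBelow hi xs ≤ 0) (lt-true x<hi) below
...   | ()
sorted-dominates lo hi y≤lo z≤hi zero (x ∷ xs) sorted (_ ∷ all≥lo) below _ | no x≮hi =
  ℚP.≤-trans z≤hi (ℕ→ℚ-mono (≮⇒≥ x≮hi)) ∷
  sorted-dominates lo hi y≤lo z≤hi zero xs (Linked.tail sorted) all≥lo (m+n≤o⇒n≤o (bit (lt x hi)) below) z≤n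
sorted-dominates lo hi y≤lo z≤hi (suc c) (x ∷ xs) sorted (lo≤x ∷ all≥lo) below (s≤s c≤) =
  ℚP.≤-trans y≤lo (ℕ→ℚ-mono lo≤x) ∷
  sorted-dominates lo hi y≤lo z≤hi c xs (Linked.tail sorted) all≥lo (countBelow-tail hi x xs c sorted below) c≤

sum-map-mono : ∀ {V : Set} {f g : V → ℕ} (vs : List V) → (∀ v → f v ≤ g v) → sum (map f vs) ≤ sum (map g vs)
sum-map-mono []       _ = z≤n
sum-map-mono (v ∷ vs) h = +-mono-≤ (h v) (sum-map-mono vs h)

sortedValues-dominate : ∀ {n lo hi c} {y z : ℚ} (deg : Fin n → ℕ) (exc : Fin n → Bool) →
  y ℚ.≤ ℕ→ℚ lo → z ℚ.≤ ℕ→ℚ hi → c ≤ n →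
  (∀ v → lo ≤ deg v) → (∀ v → exc v ≡ false → hi ≤ deg v) → count exc ≤ c →
  Dominates (map ℕ→ℚ (sort (map deg (allFin n)))) (replicate c y ++ replicate (n ∸ c) z)
sortedValues-dominate {n} {lo} {hi} {c} {y} {z} deg exc y≤lo z≤hi c≤n lo≤deg hi≤deg few =
  subst (λ m → Pointwise ℚ._≤_ (replicate c y ++ replicate (m ∸ c) z) (map ℕ→ℚ sorted)) length-sorted
    (sorted-dominates lo hi y≤lo z≤hi c sorted (sort-↗ values) all≥lo below≤c (subst (c ≤_) (sym length-sorted) c≤n))
  where
  values sorted : List ℕ
  values = map deg (allFin n)
  sorted = sort values
  length-sorted : length sorted ≡ n
  length-sorted = trans (↭-length (sort-↭ values)) (trans (length-map deg (allFin n)) (length-tabulate id))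
  all≥lo : All (lo ≤_) sorted
  all≥lo = All-resp-↭ (↭-sym (sort-↭ values)) (All.map⁺ (All.tabulate⁺ lo≤deg))
  below⇒exc : ∀ v → lt (deg v) hi ≡ true → exc v ≡ true
  below⇒exc v below with exc v in eq
  ... | true  = refl
  ... | false = contradiction (lt-sound below) (≤⇒≯ (hi≤deg v eq))
  below≤c : countBelow hi sorted ≤ c
  below≤c = begin
    countBelow hi sorted                               ≡⟨ sum-↭ (↭.map⁺ (λ x → bit (lt x hi)) (sort-↭ values)) ⟩
    countBelow hi values                               ≡⟨ cong sum (sym (map-∘ (allFin n))) ⟩
    sum (map (λ v → bit (lt (deg v) hi)) (allFin n))   ≤⟨ sum-map-mono (allFin n) (λ v → bit-mono (below⇒exc v)) ⟩
    count exc                                          ≤⟨ few ⟩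
    c                                                  ∎
    where open ≤-Reasoning

fraction-≤ : ∀ {p d N M} .{cop : Coprime p (suc d)} → p * N ≤ M * suc d →
  ℚ.mkℚ (+ p) d cop ℚ.* ℕ→ℚ N ℚ.≤ ℕ→ℚ M
fraction-≤ {p} {d} {N} {M} {cop} pN≤Md rewrite ℕ→ℚ-normal N | ℕ→ℚ-normal M =
  ℚP.toℚᵘ-cancel-≤ (ℚᵘP.≤-respˡ-≃
    (ℚᵘP.≃-sym (ℚP.toℚᵘ-homo-* (ℚ.mkℚ (+ p) d cop) (ℚ.mkℚ (+ N) 0 (Coprime-sym (1-coprimeTo N)))))
    (ℚᵘ.*≤* (subst₂ ℤ._≤_ (sym (ℤP.*-identityʳ _)) (cong (λ x → + M ℤ.* + suc x) (sym (*-identityʳ d)))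
      (subst₂ ℤ._≤_ (ℤP.pos-* p N) (ℤP.pos-* M (suc d)) (ℤ.+≤+ pN≤Md)))))

three-eighths : (+ 3) / 8 ≡ ℚ.mkℚ (+ 3) 7 (gcd≡1⇒coprime refl)
three-eighths = ℚP.normalize-coprime (gcd≡1⇒coprime refl)

below-3/8 : ∀ {p d} .{cop : Coprime p (suc d)} → ℚ.mkℚ (+ p) d cop < (+ 3) / 8 → p * 8 ℕ.< 3 * suc d
below-3/8 {p} {d} {cop} α<3/8 =
  ℤP.drop‿+<+ (subst₂ ℤ._<_ (sym (ℤP.pos-* p 8)) (sym (ℤP.pos-* 3 (suc d)))
    (ℚP.drop-*<* (subst (ℚ.mkℚ (+ p) d cop <_) three-eighths α<3/8)))

fraction-bound : ∀ p q n ℓ X → p * 8 ℕ.< 3 * q → 3 * n ≡ 8 * ℓ + X → q * X ≤ n → p * n ≤ ℓ * q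
fraction-bound p q n ℓ X 8p<3q 3n≡8ℓ+X qX≤n =
  *-cancelˡ-≤ 8 (+-cancelʳ-≤ n (8 * (p * n)) (8 * (ℓ * q)) (begin
    8 * (p * n) + n       ≡⟨ gather p n ⟩
    suc (p * 8) * n       ≤⟨ *-monoˡ-≤ n 8p<3q ⟩
    3 * q * n             ≡⟨ reorder q n ⟩
    q * (3 * n)           ≡⟨ cong (q *_) 3n≡8ℓ+X ⟩
    q * (8 * ℓ + X)       ≡⟨ expand q ℓ X ⟩
    8 * (ℓ * q) + q * X   ≤⟨ +-monoʳ-≤ (8 * (ℓ * q)) qX≤n ⟩
    8 * (ℓ * q) + n       ∎))
  where
  open ≤-Reasoning
  gather : ∀ p n → 8 * (p * n) + n ≡ suc (p * 8) * n
  gather = solve-∀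
  reorder : ∀ q n → 3 * q * n ≡ q * (3 * n)
  reorder = solve-∀
  expand : ∀ q ℓ X → q * (8 * ℓ + X) ≡ 8 * (ℓ * q) + q * X
  expand = solve-∀

-- Vertices of the construction: position w of block β in the class A or C,
-- and the classes B₁, B₂, D₁, D₂, whose members are indistinguishable.
data Vertex : Set where
  A C         : (β w : ℕ) → Vertex
  B₁ B₂ D₁ D₂ : Vertex

inAB inAD : Vertex → Bool
inAB (A _ _) = true
inAB B₁      = true
inAB B₂      = true
inAB _       = false
inAD (A _ _) = true
inAD D₁      = true
inAD D₂      = true
inAD _       = false

module Construction (q k : ℕ) where

  r L P a δ n : ℕ
  r = suc (q + q)               -- blocks in A and in C
  L = suc (k + k)               -- regular positions per block
  P = L + 4                     -- block size: 4 exceptional positions per block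
  a = r * P
  δ = q * P + k + 1             -- |B₂| = |D₁| = |D₂| = δ and |B₁| = δ + 1
  n = a + (a + (suc δ + (δ + (δ + δ))))

  edge : Vertex → Vertex → Bool
  edge (A β w) (A β′ w′) = blowUp q (innerA k) β w β′ w′
  edge (C β w) (C β′ w′) = blowUp q (innerC k) β w β′ w′
  edge (A _ _) (C _ _)   = true
  edge (A _ _) B₁        = true
  edge (A _ _) B₂        = true
  edge B₁      (C _ _)   = true
  edge B₂      (C _ _)   = true
  edge (C _ _) D₁        = true
  edge (C _ _) D₂        = true
  edge B₁      D₁        = true
  edge D₁      B₂        = true
  edge B₂      D₂        = true
  edge D₂      B₁        = true
  edge D₁      (A _ _)   = true
  edge D₂      (A _ _)   = true
  edge _       _         = false

  edge-irrefl : ∀ K → edge K K ≡ false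
  edge-irrefl (A β w) = blowUp-irrefl q (innerA k) β w (innerA-irrefl k w)
  edge-irrefl (C β w) = blowUp-irrefl q (innerC k) β w (innerC-irrefl k w)
  edge-irrefl B₁      = refl
  edge-irrefl B₂      = refl
  edge-irrefl D₁      = refl
  edge-irrefl D₂      = refl

  edge-anti : ∀ K K′ → edge K K′ ≡ true → edge K′ K ≡ false
  edge-anti (A β w) (A β′ w′) = blowUp-anti q (innerA k) (innerA-anti k) β w β′ w′
  edge-anti (A _ _) (C _ _)   _  = refl
  edge-anti (A _ _) B₁        _  = refl
  edge-anti (A _ _) B₂        _  = refl
  edge-anti (A _ _) D₁        ()
  edge-anti (A _ _) D₂        ()
  edge-anti (C _ _) (A _ _)   ()
  edge-anti (C β w) (C β′ w′) = blowUp-anti q (innerC k) (innerC-anti k) β w β′ w′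
  edge-anti (C _ _) B₁        ()
  edge-anti (C _ _) B₂        ()
  edge-anti (C _ _) D₁        _  = refl
  edge-anti (C _ _) D₂        _  = refl
  edge-anti B₁      (A _ _)   ()
  edge-anti B₁      (C _ _)   _  = refl
  edge-anti B₁      B₁        ()
  edge-anti B₁      B₂        ()
  edge-anti B₁      D₁        _  = refl
  edge-anti B₁      D₂        ()
  edge-anti B₂      (A _ _)   ()
  edge-anti B₂      (C _ _)   _  = refl
  edge-anti B₂      B₁        ()
  edge-anti B₂      B₂        ()
  edge-anti B₂      D₁        ()
  edge-anti B₂      D₂        _  = refl
  edge-anti D₁      (A _ _)   _  = refl
  edge-anti D₁      (C _ _)   ()
  edge-anti D₁      B₁        ()
  edge-anti D₁      B₂        _  = refl
  edge-anti D₁      D₁        ()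
  edge-anti D₁      D₂        ()
  edge-anti D₂      (A _ _)   _  = refl
  edge-anti D₂      (C _ _)   ()
  edge-anti D₂      B₁        _  = refl
  edge-anti D₂      B₂        ()
  edge-anti D₂      D₁        ()
  edge-anti D₂      D₂        ()

  entersAB : ∀ K K′ → edge K K′ ≡ true → inAB K′ ≡ true → inAD K ≡ true
  entersAB _       (C _ _) _  ()
  entersAB _       D₁      _  ()
  entersAB _       D₂      _  ()
  entersAB (A _ _) _       _  _ = refl
  entersAB D₁      _       _  _ = refl
  entersAB D₂      _       _  _ = refl
  entersAB (C _ _) (A _ _) ()
  entersAB (C _ _) B₁      ()
  entersAB (C _ _) B₂      ()
  entersAB B₁      (A _ _) ()
  entersAB B₁      B₁      ()
  entersAB B₁      B₂      ()
  entersAB B₂      (A _ _) ()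
  entersAB B₂      B₁      ()
  entersAB B₂      B₂      ()

  -- Vertex number v lies, in this order, in A, C, B₁, B₂, D₁ or D₂; inside A
  -- and C, v = β P + w is position w of block β.
  blocks : (ℕ → ℕ → Vertex) → ℕ → Vertex
  blocks V v = V (v /ℕ P) (v % P)

  classesBD : ℕ → Vertex
  classesBD = glue (suc δ) (λ _ → B₁) (glue δ (λ _ → B₂) (glue δ (λ _ → D₁) (λ _ → D₂)))

  layout : ℕ → Vertex
  layout = glue a (blocks A) (glue a (blocks C) classesBD)

  Valid : Vertex → Set
  Valid (A β _) = β ℕ.< r
  Valid (C β _) = β ℕ.< r
  Valid _       = ⊤

  layout-valid : ∀ u → u ℕ.< n → Valid (layout u)
  layout-valid u u<n =
    glue-all Valid a (blocks A) (glue a (blocks C) classesBD) _ u u<n block<r (λ v v< →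
    glue-all Valid a (blocks C) classesBD _ v v< block<r (λ v v< →
    glue-all Valid (suc δ) (λ _ → B₁) (glue δ (λ _ → B₂) (glue δ (λ _ → D₁) (λ _ → D₂))) _ v v<
      (λ _ _ → tt) (λ v v< →
    glue-all Valid δ (λ _ → B₂) (glue δ (λ _ → D₁) (λ _ → D₂)) _ v v< (λ _ _ → tt) (λ v v< →
    glue-all Valid δ (λ _ → D₁) (λ _ → D₂) δ v v< (λ _ _ → tt) (λ _ _ → tt)))))
    where
    block<r : ∀ v → v ℕ.< a → v /ℕ P ℕ.< r
    block<r v v<a = m<n*o⇒m/o<n v<a

  ΣA ΣC : (Vertex → ℕ) → ℕ
  ΣA f = Σ< (λ β → Σ< (λ w → f (A β w)) P) r
  ΣC f = Σ< (λ β → Σ< (λ w → f (C β w)) P) r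

  classSums : ∀ f → Σ< (f ∘ layout) n ≡
    ΣA f + (ΣC f + (suc δ * f B₁ + (δ * f B₂ + (δ * f D₁ + δ * f D₂))))
  classSums f =
    trans (Σ<-glue f a (blocks A) (glue a (blocks C) classesBD) _)
          (cong₂ _+_ (Σ<-blocks P (λ β w → f (A β w)) r)
    (trans (Σ<-glue f a (blocks C) classesBD _)
           (cong₂ _+_ (Σ<-blocks P (λ β w → f (C β w)) r)
    (trans (Σ<-glue f (suc δ) (λ _ → B₁) (glue δ (λ _ → B₂) (glue δ (λ _ → D₁) (λ _ → D₂))) _)
           (cong₂ _+_ (Σ<-const _ (suc δ))
    (trans (Σ<-glue f δ (λ _ → B₂) (glue δ (λ _ → D₁) (λ _ → D₂)) _)
           (cong₂ _+_ (Σ<-const _ δ)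
    (trans (Σ<-glue f δ (λ _ → D₁) (λ _ → D₂) δ)
           (cong₂ _+_ (Σ<-const _ δ) (Σ<-const _ δ))))))))))

  classSums-≥ : ∀ f {x y z u v w} → x ≤ ΣA f → y ≤ ΣC f → z ≤ suc δ * f B₁ →
    u ≤ δ * f B₂ → v ≤ δ * f D₁ → w ≤ δ * f D₂ → x + (y + (z + (u + (v + w)))) ≤ Σ< (f ∘ layout) n
  classSums-≥ f x≤ y≤ z≤ u≤ v≤ w≤ =
    ≤-trans (+-mono-≤ x≤ (+-mono-≤ y≤ (+-mono-≤ z≤ (+-mono-≤ u≤ (+-mono-≤ v≤ w≤)))))
            (≤-reflexive (sym (classSums f)))

  ΣA-ones : ∀ f → (∀ β w → f (A β w) ≡ 1) → ΣA f ≡ a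
  ΣA-ones f full = Σ<-constOn P r (λ β _ → trans (Σ<-constOn 1 P (λ w _ → full β w)) (*-identityʳ P))

  ΣA-full : ∀ f → (∀ β w → f (A β w) ≡ 1) → a ≤ ΣA f
  ΣA-full f full = ≤-reflexive (sym (ΣA-ones f full))

  ΣC-full : ∀ f → (∀ β w → f (C β w) ≡ 1) → a ≤ ΣC f
  ΣC-full f full = ≤-reflexive (sym
    (Σ<-constOn P r (λ β _ → trans (Σ<-constOn 1 P (λ w _ → full β w)) (*-identityʳ P))))

  ΣC-empty : ∀ f → (∀ β w → f (C β w) ≡ 0) → ΣC f ≡ 0
  ΣC-empty f empty =
    trans (Σ<-constOn 0 r (λ β _ → trans (Σ<-constOn 0 P (λ w _ → empty β w)) (*-zeroʳ P))) (*-zeroʳ r)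

  edgesInto edgesFrom : Vertex → Vertex → ℕ
  edgesInto K′ K = bit (edge K K′)
  edgesFrom K K′ = bit (edge K K′)

  indeg′ outdeg′ : Vertex → ℕ
  indeg′  K = Σ< (edgesInto K ∘ layout) n
  outdeg′ K = Σ< (edgesFrom K ∘ layout) n

  -- The two degree thresholds: every vertex reaches lo, regular ones hi.
  hi lo : ℕ
  hi = a + δ
  lo = q * P + (δ + δ)

  hi≤a+δ : hi ≤ a + (δ + 0)
  hi≤a+δ = ≤-reflexive (cong (_+_ a) (sym (+-identityʳ δ)))

  δ≤δ : δ ≤ δ * 1
  δ≤δ = ≤-reflexive (sym (*-identityʳ δ))

  δ≤1+δ : δ ≤ suc δ * 1
  δ≤1+δ = ≤-trans (n≤1+n δ) (≤-reflexive (sym (*-identityʳ (suc δ))))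

  -- An A-vertex sends edges to all of C and B₂; a C-vertex receives edges
  -- from all of A and B₂.
  outdeg-A : ∀ β w → hi ≤ outdeg′ (A β w)
  outdeg-A β w = ≤-trans hi≤a+δ (classSums-≥ (edgesFrom (A β w))
    z≤n (ΣC-full (edgesFrom (A β w)) (λ _ _ → refl)) z≤n δ≤δ z≤n z≤n)

  indeg-C : ∀ β w → hi ≤ indeg′ (C β w)
  indeg-C β w = ≤-trans hi≤a+δ (classSums-≥ (edgesInto (C β w))
    (ΣA-full (edgesInto (C β w)) (λ _ _ → refl)) z≤n z≤n δ≤δ z≤n z≤n)

  -- An A-vertex receives edges from its own class through the blow-up and
  -- from all of D; dually for the out-edges of a C-vertex.
  indeg-A : ∀ β w → β ℕ.< r → Σ< (λ w′ → bit (innerA k w′ w)) P + q * P + (δ + δ) ≤ indeg′ (A β w)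
  indeg-A β w β<r = classSums-≥ (edgesInto (A β w))
    (≤-reflexive (sym (blowUp-indeg q P (innerA k) β w β<r))) z≤n z≤n z≤n δ≤δ δ≤δ

  outdeg-C : ∀ β w → β ℕ.< r → Σ< (λ w′ → bit (innerC k w w′)) P + q * P + (δ + δ) ≤ outdeg′ (C β w)
  outdeg-C β w β<r = classSums-≥ (edgesFrom (C β w))
    z≤n (≤-reflexive (sym (blowUp-outdeg q P (innerC k) β w β<r))) z≤n z≤n δ≤δ δ≤δ

  -- Each vertex of B ∪ D has an entire class of size ≥ a and one of size
  -- ≥ δ on either side.
  degrees-B₁ : hi ≤ indeg′ B₁ × hi ≤ outdeg′ B₁
  degrees-B₁ =
    classSums-≥ (edgesInto B₁) (ΣA-full (edgesInto B₁) (λ _ _ → refl)) z≤n z≤n z≤n z≤n δ≤δ ,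
    ≤-trans hi≤a+δ (classSums-≥ (edgesFrom B₁) z≤n (ΣC-full (edgesFrom B₁) (λ _ _ → refl)) z≤n z≤n δ≤δ z≤n)

  degrees-B₂ : hi ≤ indeg′ B₂ × hi ≤ outdeg′ B₂
  degrees-B₂ =
    ≤-trans hi≤a+δ (classSums-≥ (edgesInto B₂) (ΣA-full (edgesInto B₂) (λ _ _ → refl)) z≤n z≤n z≤n δ≤δ z≤n) ,
    classSums-≥ (edgesFrom B₂) z≤n (ΣC-full (edgesFrom B₂) (λ _ _ → refl)) z≤n z≤n z≤n δ≤δ

  degrees-D₁ : hi ≤ indeg′ D₁ × hi ≤ outdeg′ D₁
  degrees-D₁ =
    ≤-trans hi≤a+δ (classSums-≥ (edgesInto D₁) z≤n (ΣC-full (edgesInto D₁) (λ _ _ → refl)) δ≤1+δ z≤n z≤n z≤n) ,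
    ≤-trans hi≤a+δ (classSums-≥ (edgesFrom D₁) (ΣA-full (edgesFrom D₁) (λ _ _ → refl)) z≤n z≤n δ≤δ z≤n z≤n)

  degrees-D₂ : hi ≤ indeg′ D₂ × hi ≤ outdeg′ D₂
  degrees-D₂ =
    ≤-trans hi≤a+δ (classSums-≥ (edgesInto D₂) z≤n (ΣC-full (edgesInto D₂) (λ _ _ → refl)) z≤n δ≤δ z≤n z≤n) ,
    ≤-trans hi≤a+δ (classSums-≥ (edgesFrom D₂) (ΣA-full (edgesFrom D₂) (λ _ _ → refl)) z≤n δ≤1+δ z≤n z≤n z≤n)

  -- hi is exactly the indegree of a regular A-vertex (and outdegree of a
  -- regular C-vertex): k + 4 inside its block, q P from other blocks, 2δ from D.
  hi-split : hi ≡ k + 4 + q * P + (δ + δ)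
  hi-split = identity q k
    where
    identity : ∀ q k → let P = suc (k + k) + 4 ; δ = q * P + k + 1 in
      suc (q + q) * P + δ ≡ k + 4 + q * P + (δ + δ)
    identity = solve-∀

  -- lo is what remains of such a degree when the k + 4 from the block are lost.
  lo≤+ : ∀ X → lo ≤ X + q * P + (δ + δ)
  lo≤+ X = +-monoˡ-≤ (δ + δ) (m≤n+m (q * P) X)

  lo≤hi : lo ≤ hi
  lo≤hi = subst (lo ≤_) (sym hi-split) (lo≤+ (k + 4))

  isExc : Vertex → Bool
  isExc (A _ w) = not (lt w L)
  isExc (C _ w) = not (lt w L)
  isExc _       = false

  hi≤deg : ∀ K → Valid K → isExc K ≡ false → hi ≤ indeg′ K × hi ≤ outdeg′ K
  hi≤deg (A β w) β<r regular = ≤-trans (≤-reflexive regular-indeg) (indeg-A β w β<r) , outdeg-A β w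
    where
    regular-indeg : hi ≡ Σ< (λ w′ → bit (innerA k w′ w)) P + q * P + (δ + δ)
    regular-indeg = trans hi-split (cong (λ t → t + q * P + (δ + δ))
                      (sym (innerA-indeg k 4 w (lt-sound (not-false regular)))))
  hi≤deg (C β w) β<r regular = indeg-C β w , ≤-trans (≤-reflexive regular-outdeg) (outdeg-C β w β<r)
    where
    regular-outdeg : hi ≡ Σ< (λ w′ → bit (innerC k w w′)) P + q * P + (δ + δ)
    regular-outdeg = trans hi-split (cong (λ t → t + q * P + (δ + δ))
                       (sym (innerC-outdeg k 4 w (lt-sound (not-false regular)))))
  hi≤deg B₁ _ _ = degrees-B₁
  hi≤deg B₂ _ _ = degrees-B₂
  hi≤deg D₁ _ _ = degrees-D₁
  hi≤deg D₂ _ _ = degrees-D₂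

  lo≤deg : ∀ K → Valid K → lo ≤ indeg′ K × lo ≤ outdeg′ K
  lo≤deg (A β w) β<r = ≤-trans (lo≤+ (Σ< (λ w′ → bit (innerA k w′ w)) P)) (indeg-A β w β<r) ,
                       ≤-trans lo≤hi (outdeg-A β w)
  lo≤deg (C β w) β<r = ≤-trans lo≤hi (indeg-C β w) ,
                       ≤-trans (lo≤+ (Σ< (λ w′ → bit (innerC k w w′)) P)) (outdeg-C β w β<r)
  lo≤deg B₁ _ = Product.map (≤-trans lo≤hi) (≤-trans lo≤hi) degrees-B₁
  lo≤deg B₂ _ = Product.map (≤-trans lo≤hi) (≤-trans lo≤hi) degrees-B₂
  lo≤deg D₁ _ = Product.map (≤-trans lo≤hi) (≤-trans lo≤hi) degrees-D₁
  lo≤deg D₂ _ = Product.map (≤-trans lo≤hi) (≤-trans lo≤hi) degrees-D₂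

  -- Four exceptional positions in each of the 2r blocks.
  c : ℕ
  c = r * 4 + r * 4

  exc-count : Σ< (bit ∘ isExc ∘ layout) n ≡ c
  exc-count = begin
    Σ< (bit ∘ isExc ∘ layout) n
      ≡⟨ classSums (bit ∘ isExc) ⟩
    ΣA (bit ∘ isExc) + (ΣC (bit ∘ isExc) + (suc δ * 0 + (δ * 0 + (δ * 0 + δ * 0))))
      ≡⟨ cong₂ _+_ per-class (cong₂ _+_ per-class (no-others δ)) ⟩
    r * 4 + (r * 4 + 0)
      ≡⟨ cong (_+_ (r * 4)) (+-identityʳ (r * 4)) ⟩
    c ∎
    where
    open ≡-Reasoning
    per-class : Σ< (λ β → Σ< (λ w → bit (not (lt w L))) P) r ≡ r * 4
    per-class = Σ<-constOn 4 r (λ _ _ → exceptional-count k 4)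
    no-others : ∀ d → suc d * 0 + (d * 0 + (d * 0 + d * 0)) ≡ 0
    no-others = solve-∀

  AB-count : Σ< (bit ∘ inAB ∘ layout) n ≡ a + suc (δ + δ)
  AB-count = trans (classSums (bit ∘ inAB)) (cong₂ _+_ (ΣA-ones (bit ∘ inAB) (λ _ _ → refl))
    (trans (cong₂ _+_ (ΣC-empty (bit ∘ inAB) (λ _ _ → refl)) refl) (only-B δ)))
    where
    only-B : ∀ d → 0 + (suc d * 1 + (d * 1 + (d * 0 + d * 0))) ≡ suc (d + d)
    only-B = solve-∀

  AD-count : Σ< (bit ∘ inAD ∘ layout) n ≡ a + (δ + δ)
  AD-count = trans (classSums (bit ∘ inAD)) (cong₂ _+_ (ΣA-ones (bit ∘ inAD) (λ _ _ → refl))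
    (trans (cong₂ _+_ (ΣC-empty (bit ∘ inAD) (λ _ _ → refl)) refl) (only-D δ)))
    where
    only-D : ∀ d → 0 + (suc d * 0 + (d * 0 + (d * 1 + d * 1))) ≡ d + d
    only-D = solve-∀

  vertex : Fin n → Vertex
  vertex = layout ∘ toℕ

  vertex-valid : ∀ v → Valid (vertex v)
  vertex-valid v = layout-valid (toℕ v) (toℕ<n v)

  G : Digraph n
  G u v = edge (vertex u) (vertex v)

  G-oriented : IsOriented G
  G-oriented = (λ u → edge-irrefl (vertex u)) , (λ u v → edge-anti (vertex u) (vertex v))

  G-nonHamiltonian : ¬ HamiltonCycle G
  G-nonHamiltonian = noHamiltonCycle G (inAB ∘ vertex) (inAD ∘ vertex) (λ u v → entersAB (vertex u) (vertex v))
    (subst₂ ℕ._<_ (sym (trans (sum-allFin-toℕ n (bit ∘ inAD ∘ layout)) AD-count))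
                  (sym (trans (sum-allFin-toℕ n (bit ∘ inAB ∘ layout)) AB-count))
                  (+-monoʳ-< a (n<1+n (δ + δ))))

  indeg-vertex : ∀ v → indeg G v ≡ indeg′ (vertex v)
  indeg-vertex v = sum-allFin-toℕ n (λ j → bit (edge (layout j) (vertex v)))

  outdeg-vertex : ∀ v → outdeg G v ≡ outdeg′ (vertex v)
  outdeg-vertex v = sum-allFin-toℕ n (λ j → bit (edge (vertex v) (layout j)))

  few-exceptional : count (isExc ∘ vertex) ≤ c
  few-exceptional = ≤-reflexive (trans (sum-allFin-toℕ n (bit ∘ isExc ∘ layout)) exc-count)

  c≤n : c ≤ n
  c≤n = +-mono-≤ 4r≤a (≤-trans 4r≤a (m≤m+n a _))
    where
    4r≤a : r * 4 ≤ a
    4r≤a = *-monoʳ-≤ r (m≤n+m 4 L)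

  indegSeq-dominates : ∀ {y z : ℚ} → y ℚ.≤ ℕ→ℚ lo → z ℚ.≤ ℕ→ℚ hi →
    Dominates (map ℕ→ℚ (indegSeq G)) (replicate c y ++ replicate (n ∸ c) z)
  indegSeq-dominates y≤lo z≤hi = sortedValues-dominate (indeg G) (isExc ∘ vertex) y≤lo z≤hi c≤n
    (λ v → subst (lo ≤_) (sym (indeg-vertex v)) (proj₁ (lo≤deg (vertex v) (vertex-valid v))))
    (λ v regular → subst (hi ≤_) (sym (indeg-vertex v)) (proj₁ (hi≤deg (vertex v) (vertex-valid v) regular)))
    few-exceptional

  outdegSeq-dominates : ∀ {y z : ℚ} → y ℚ.≤ ℕ→ℚ lo → z ℚ.≤ ℕ→ℚ hi →
    Dominates (map ℕ→ℚ (outdegSeq G)) (replicate c y ++ replicate (n ∸ c) z)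
  outdegSeq-dominates y≤lo z≤hi = sortedValues-dominate (outdeg G) (isExc ∘ vertex) y≤lo z≤hi c≤n
    (λ v → subst (lo ≤_) (sym (outdeg-vertex v)) (proj₂ (lo≤deg (vertex v) (vertex-valid v))))
    (λ v regular → subst (hi ≤_) (sym (outdeg-vertex v)) (proj₂ (hi≤deg (vertex v) (vertex-valid v) regular)))
    few-exceptional

  -- The graphs get arbitrarily large: n ≥ k.
  k≤n : k ≤ n
  k≤n = ≤-trans k≤δ (≤-trans (n≤1+n δ) (≤-trans (m≤m+n (suc δ) _) (≤-trans (m≤n+m _ a) (m≤n+m _ a))))
    where
    k≤δ : k ≤ δ
    k≤δ = ≤-trans (m≤n+m k (q * P)) (m≤m+n (q * P + k) 1)

  -- 3n/8 ≤ hi, cross-multiplied.  Here and below, polynomial identities in q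
  -- and k are checked by the ring solver, with the definitions of P, δ, a,
  -- n and lo repeated as lets.
  3n≤hi*8 : 3 * n ≤ hi * 8
  3n≤hi*8 = ≤-trans (m≤m+n (3 * n) 3) (≤-reflexive (sym (identity q k)))
    where
    identity : ∀ q k → let P = suc (k + k) + 4 ; δ = q * P + k + 1 ; a = suc (q + q) * P
                           n = a + (a + (suc δ + (δ + (δ + δ)))) in
      (a + δ) * 8 ≡ 3 * n + 3
    identity = solve-∀

  pn≤lo*q : ∀ p → p * 8 ℕ.< 3 * q → p * n ≤ lo * q
  pn≤lo*q p 8p<3q = fraction-bound p q n lo (8 * k + 29) 8p<3q (three-n q k)
                      (≤-trans (m≤m+n _ _) (≤-reflexive (sym (n-split q k))))
    where
    three-n : ∀ q k → let P = suc (k + k) + 4 ; δ = q * P + k + 1 ; a = suc (q + q) * P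
                          n = a + (a + (suc δ + (δ + (δ + δ)))) ; lo = q * P + (δ + δ) in
      3 * n ≡ 8 * lo + (8 * k + 29)
    three-n = solve-∀
    n-split : ∀ q k → let P = suc (k + k) + 4 ; δ = q * P + k + 1 ; a = suc (q + q) * P in
      a + (a + (suc δ + (δ + (δ + δ)))) ≡ q * (8 * k + 29) + (8 * q * k + 11 * q + 8 * k + 15)
    n-split = solve-∀

proposition10 : (α : ℚ) → 0ℚ < α → α < (+ 3) / 8 →
    Σ ℕ λ c → (N : ℕ) → Σ ℕ λ n → n ≥ N × c ≤ n ×
      Σ (Digraph n) λ G → IsOriented G ×
        Dominates (map ℕ→ℚ (indegSeq G)) (targetSeq α c n) ×
        Dominates (map ℕ→ℚ (outdegSeq G)) (targetSeq α c n) ×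
        ¬ HamiltonCycle G
proposition10 (ℚ.mkℚ ℤ.-[1+ _ ] _ _) (ℚ.*<* ()) _
proposition10 α@(ℚ.mkℚ (+ p) d _) _ α<3/8 = Construction.c (suc d) 0 , λ N →
  let open Construction (suc d) N
      αn≤lo : α ℚ.* ℕ→ℚ n ℚ.≤ ℕ→ℚ lo
      αn≤lo = fraction-≤ {N = n} {M = lo} (pn≤lo*q p (below-3/8 α<3/8))
      3n/8≤hi : ((+ 3) / 8) ℚ.* ℕ→ℚ n ℚ.≤ ℕ→ℚ hi
      3n/8≤hi = subst (λ t → t ℚ.* ℕ→ℚ n ℚ.≤ ℕ→ℚ hi) (sym three-eighths)
                  (fraction-≤ {N = n} {M = hi} 3n≤hi*8)
  in n , k≤n , c≤n , G , G-oriented ,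
     indegSeq-dominates αn≤lo 3n/8≤hi , outdegSeq-dominates αn≤lo 3n/8≤hi ,
     G-nonHamiltonian
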